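{- Let $n$ be a $2$-near perfect number of the form $n = 2^k p^2$, where $p$ is an odd prime and $k$ is a nonnegative integer, and let $d_1, d_2$ be its omitted divisors. Then $$d_1 + d_2 = -p^2 + (2^{k+1}-1)p + (2^{k+1}-1),$$ and $d_1$ and $d_2$ are of opposite parity.
   Context: $\sigma(n)$ denotes the sum of the positive divisors of $n$. A positive integer $n$ is called $2$-near perfect if $\sigma(n) = 2n + d_1 + d_2$ for some two distinct positive divisors $d_1, d_2$ of $n$; these $d_1, d_2$ are called the omitted divisors. -}

module Defs where

open import Data.Nat using (ℕ; zero; suc; _+_; _*_)
open import Data.Nat.Divisibility using (_∣_; _∣?_)
open import Data.List using (List; filter; upTo; map)
open import Data.Nat.ListAction using (sum)
open import Data.Product using (_×_)
open import Relation.Binary.PropositionalEquality using (_≡_)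
open import Relation.Nullary using (¬_)

-- σ n = sum of the positive divisors of n  (σ 0 = 0 by convention; only n ≥ 1 is used)
σ : ℕ → ℕ
σ n = sum (filter (_∣? n) (map suc (upTo n)))

OmittedDivisors : ℕ → ℕ → ℕ → Set
OmittedDivisors n d₁ d₂ =
  1 Data.Nat.≤ d₁ × 1 Data.Nat.≤ d₂ × d₁ ∣ n × d₂ ∣ n × ¬ (d₁ ≡ d₂) × σ n ≡ 2 * n + d₁ + d₂

Even : ℕ → Set
Even n = 2 ∣ n

Odd : ℕ → Set
Odd n = ¬ (2 ∣ n)

{-# OPTIONS --safe #-}
-- If ds lists the divisors of an odd m, then ds, 2ds, …, 2ᵏds list those of 2ᵏm, so
-- σ(2ᵏm) = (2ᵏ⁺¹ − 1) σ(m). With σ(p²) = 1 + p + p², the near-perfect condition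
-- σ(n) = 2n + d₁ + d₂ for n = 2ᵏp² becomes
-- d₁ + d₂ + 2ᵏ⁺¹p² + (1 + p + p²) = 2ᵏ⁺¹(1 + p + p²),
-- which is solved for d₁ + d₂ over ℤ; since 1 + p + p² is odd, it also forces d₁ + d₂ to be odd.
module Submission where

open import Defs
open import Data.Nat using (ℕ; zero; suc; _+_; _*_; _^_; _<_; NonZero; ≢-nonZero⁻¹; nonTrivial⇒n>1)
open import Data.Nat.Primality using (Prime)
open import Data.Integer using (+_; -_)
open import Data.Product using (_×_; _,_; proj₂)
open import Data.Sum using (_⊎_; inj₁; inj₂)
open import Relation.Binary.PropositionalEquality using (_≡_)

open import Data.Nat.Properties using (+-identityʳ; *-identityʳ; *-distribˡ-+; <⇒≢; <-trans; m<m*n; *-assoc; *-comm; *-cancelˡ-≡; +-comm; suc-injective; m*n≢0; m^n≢0)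
open import Data.Nat.Divisibility
open import Data.Nat.Primality using (prime⇒irreducible; prime[2]; euclidsLemma; prime⇒nonZero; prime⇒nonTrivial)
open import Data.Nat.Coprimality using (Coprime; coprime-divisor)
open import Data.Nat.ListAction using (sum)
open import Data.Nat.ListAction.Properties using (sum-++; sum-↭)
open import Data.Nat.Tactic.RingSolver using (solve-∀)
open import Data.List using (List; []; _∷_; _++_; map; filter; upTo)
open import Data.List.Membership.Propositional using (_∈_)
open import Data.List.Membership.Propositional.Properties
open import Data.List.Membership.Propositional.Properties.WithK using (unique∧set⇒bag)
open import Data.List.Relation.Binary.BagAndSetEquality using (∼bag⇒↭)
open import Data.List.Relation.Unary.Any using (here; there)
open import Data.List.Relation.Unary.Unique.Propositional using (Unique)
import Data.List.Relation.Unary.Unique.Propositional.Properties as Unique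
import Data.List.Relation.Unary.AllPairs as AllPairs
open import Data.List.Relation.Unary.All using ([]; _∷_)
open import Function.Bundles using (_⇔_; mk⇔; Equivalence)
open import Relation.Nullary using (¬_; yes; no; contradiction)
open import Relation.Binary.PropositionalEquality using (refl; sym; trans; cong; cong₂; subst; module ≡-Reasoning)
import Data.Integer as ℤ
open import Data.Integer.Properties using (pos-*)
import Data.Integer.Tactic.RingSolver as ℤ-Solver

private
  variable
    k m n p x : ℕ
    ds : List ℕ

¬2∣1 : ¬ 2 ∣ 1
¬2∣1 2∣1 with ∣1⇒≡1 2∣1
... | ()

even⇒odd-suc : Even n → Odd (suc n)
even⇒odd-suc {n} 2∣n 2∣1+n = ¬2∣1 (∣m+n∣m⇒∣n (subst (2 ∣_) (+-comm 1 n) 2∣1+n) 2∣n)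

odd⇒even-suc : Odd n → Even (suc n)
odd⇒even-suc {zero}        odd = contradiction (2 ∣0) odd
odd⇒even-suc {suc zero}    odd = ∣-refl
odd⇒even-suc {suc (suc n)} odd =
  ∣m∣n⇒∣m+n (∣-refl {2}) (odd⇒even-suc (λ 2∣n → odd (∣m∣n⇒∣m+n (∣-refl {2}) 2∣n)))

odd*odd⇒odd : Odd m → Odd n → Odd (m * n)
odd*odd⇒odd {m} {n} odd-m odd-n 2∣mn with euclidsLemma m n prime[2] 2∣mn
... | inj₁ 2∣m = odd-m 2∣m
... | inj₂ 2∣n = odd-n 2∣n

even-n+n^2 : ∀ n → Even (n + n ^ 2)
even-n+n^2 zero    = 2 ∣0
even-n+n^2 (suc n) = subst Even (expand n) (∣m∣n⇒∣m+n (even-n+n^2 n) (n∣m*n (suc n)))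
  where
  -- n ^ 2 is spelt out as its unfolding n * (n * 1), since the solver rejects _^_ here.
  expand : ∀ n → n + n * (n * 1) + (1 + n) * 2 ≡ (1 + n) + (1 + n) * ((1 + n) * 1)
  expand = solve-∀

odd-sum⇒opposite-parity : Odd (m + n) → (Even m × Odd n) ⊎ (Odd m × Even n)
odd-sum⇒opposite-parity {m} {n} odd with 2 ∣? m | 2 ∣? n
... | yes 2∣m  | yes 2∣n  = contradiction (∣m∣n⇒∣m+n 2∣m 2∣n) odd
... | yes 2∣m  | no  odd-n = inj₁ (2∣m , odd-n)
... | no odd-m | yes 2∣n  = inj₂ (odd-m , 2∣n)
... | no odd-m | no  odd-n =
  contradiction (∣m+n∣m⇒∣n (subst (2 ∣_) (shuffle m n) (∣m∣n⇒∣m+n (odd⇒even-suc odd-m) (odd⇒even-suc odd-n))) (∣-refl {2})) odd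
  where
  shuffle : ∀ m n → (1 + m) + (1 + n) ≡ 2 + (m + n)
  shuffle = solve-∀

p^2≡p*p : ∀ p → p ^ 2 ≡ p * p
p^2≡p*p p = cong (p *_) (*-identityʳ p)

prime∤⇒coprime : Prime p → ¬ p ∣ n → Coprime n p
prime∤⇒coprime p-prime p∤n (d∣n , d∣p) with prime⇒irreducible p-prime d∣p
... | inj₁ d≡1 = d≡1
... | inj₂ refl = contradiction d∣n p∤n

odd∣2^k*m⇒∣m : ∀ k → Odd x → x ∣ 2 ^ k * m → x ∣ m
odd∣2^k*m⇒∣m {x} {m} zero    odd x∣m = subst (x ∣_) (+-identityʳ m) x∣m
odd∣2^k*m⇒∣m {x} {m} (suc k) odd x∣2^[1+k]m =
  odd∣2^k*m⇒∣m k odd (coprime-divisor (prime∤⇒coprime prime[2] odd) (subst (x ∣_) (*-assoc 2 (2 ^ k) m) x∣2^[1+k]m))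

∣odd⇒odd : x ∣ m → Odd m → Odd x
∣odd⇒odd x∣m odd 2∣x = odd (∣-trans 2∣x x∣m)

record IsDivisorList (n : ℕ) (ds : List ℕ) : Set where
  field
    unique : Unique ds
    ∈⇔∣    : ∀ {x} → x ∈ ds ⇔ x ∣ n

divisors : ℕ → List ℕ
divisors n = filter (_∣? n) (map suc (upTo n))

divisors-isDivisorList : .{{NonZero n}} → IsDivisorList n (divisors n)
divisors-isDivisorList {n} = record
  { unique = Unique.filter⁺ (_∣? n) (Unique.map⁺ suc-injective (Unique.upTo⁺ n))
  ; ∈⇔∣    = mk⇔ (λ x∈ → proj₂ (∈-filter⁻ (_∣? n) {xs = map suc (upTo n)} x∈)) ∈divisors
  }
  where
  ∈divisors : x ∣ n → x ∈ divisors n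
  ∈divisors {zero}  0∣n   = contradiction (0∣⇒≡0 0∣n) (≢-nonZero⁻¹ n)
  ∈divisors {suc x} x+1∣n = ∈-filter⁺ (_∣? n) (∈-map⁺ suc (∈-upTo⁺ (∣⇒≤ x+1∣n))) x+1∣n

σ≡sum : .{{NonZero n}} → IsDivisorList n ds → σ n ≡ sum ds
σ≡sum {n} {ds} ds-divisorList = sum-↭ (∼bag⇒↭ (unique∧set⇒bag (unique divisorList) (unique ds-divisorList)
  (mk⇔ (λ x∈ → from (∈⇔∣ ds-divisorList) (to (∈⇔∣ divisorList) x∈))
       (λ x∈ → from (∈⇔∣ divisorList) (to (∈⇔∣ ds-divisorList) x∈)))))
  where
  open IsDivisorList
  open Equivalence
  divisorList = divisors-isDivisorList {n}

doublings : ℕ → List ℕ → List ℕ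
doublings zero    ds = ds
doublings (suc k) ds = ds ++ map (2 *_) (doublings k ds)

sum-map-2* : ∀ xs → sum (map (2 *_) xs) ≡ 2 * sum xs
sum-map-2* []       = refl
sum-map-2* (x ∷ xs) = trans (cong (λ t → 2 * x + t) (sum-map-2* xs)) (sym (*-distribˡ-+ 2 x (sum xs)))

sum-doublings : ∀ k ds → sum (doublings k ds) + sum ds ≡ 2 ^ suc k * sum ds
sum-doublings zero    ds = twice (sum ds)
  where
  twice : ∀ s → s + s ≡ 2 * s
  twice = solve-∀
sum-doublings (suc k) ds = begin
  sum (ds ++ map (2 *_) (doublings k ds)) + s     ≡⟨ cong (_+ s) (sum-++ ds _) ⟩
  s + sum (map (2 *_) (doublings k ds)) + s       ≡⟨ cong (λ t → s + t + s) (sum-map-2* (doublings k ds)) ⟩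
  s + 2 * sum (doublings k ds) + s                ≡⟨ regroup s (sum (doublings k ds)) ⟩
  2 * (sum (doublings k ds) + s)                  ≡⟨ cong (2 *_) (sum-doublings k ds) ⟩
  2 * (2 ^ suc k * s)                             ≡⟨ *-assoc 2 (2 ^ suc k) s ⟨
  2 ^ suc (suc k) * s                             ∎
  where
  open ≡-Reasoning
  s = sum ds
  regroup : ∀ s t → s + 2 * t + s ≡ 2 * (t + s)
  regroup = solve-∀

∈-doublings⁺ : ∀ k → x ∈ ds → x ∈ doublings k ds
∈-doublings⁺ zero    x∈ds = x∈ds
∈-doublings⁺ (suc k) x∈ds = ∈-++⁺ˡ x∈ds

module _ {m ds} (odd-m : Odd m) (divisorList : IsDivisorList m ds) where
  open IsDivisorList divisorList renaming (unique to ds-unique; ∈⇔∣ to ∈ds⇔∣)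
  open Equivalence

  ∈-doublings⇒∣ : ∀ k → x ∈ doublings k ds → x ∣ 2 ^ k * m
  ∈-doublings⇒∣ {x} zero x∈ = subst (x ∣_) (sym (+-identityʳ m)) (to ∈ds⇔∣ x∈)
  ∈-doublings⇒∣ (suc k) x∈ with ∈-++⁻ ds x∈
  ... | inj₁ x∈ds = ∣-trans (to ∈ds⇔∣ x∈ds) (n∣m*n (2 ^ suc k))
  ... | inj₂ x∈2ds with ∈-map⁻ (2 *_) x∈2ds
  ...   | y , y∈ , refl = subst (2 * y ∣_) (sym (*-assoc 2 (2 ^ k) m)) (*-monoʳ-∣ 2 (∈-doublings⇒∣ k y∈))

  ∣⇒∈-doublings : ∀ k → x ∣ 2 ^ k * m → x ∈ doublings k ds
  ∣⇒∈-doublings {x} k x∣ with 2 ∣? x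
  ... | no odd-x = ∈-doublings⁺ k (from ∈ds⇔∣ (odd∣2^k*m⇒∣m k odd-x x∣))
  ∣⇒∈-doublings zero    x∣ | yes 2∣x = contradiction (∣-trans 2∣x (subst (_ ∣_) (+-identityʳ m) x∣)) odd-m
  ∣⇒∈-doublings (suc k) x∣ | yes (divides q refl) =
    ∈-++⁺ʳ ds (subst (_∈ map (2 *_) (doublings k ds)) (*-comm 2 q) (∈-map⁺ (2 *_) (∣⇒∈-doublings k q∣)))
    where
    q∣ : q ∣ 2 ^ k * m
    q∣ = *-cancelʳ-∣ 2 (subst (q * 2 ∣_) (trans (*-assoc 2 (2 ^ k) m) (*-comm 2 (2 ^ k * m))) x∣)

  doublings-unique : ∀ k → Unique (doublings k ds)
  doublings-unique zero    = ds-unique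
  doublings-unique (suc k) =
    Unique.++⁺ ds-unique (Unique.map⁺ (*-cancelˡ-≡ _ _ 2) (doublings-unique k)) disjoint
    where
    disjoint : ∀ {x} → ¬ (x ∈ ds × x ∈ map (2 *_) (doublings k ds))
    disjoint (x∈ds , x∈2ds) with ∈-map⁻ (2 *_) x∈2ds
    ... | y , _ , refl = ∣odd⇒odd (to ∈ds⇔∣ x∈ds) odd-m (m∣m*n y)

  doublings-isDivisorList : ∀ k → IsDivisorList (2 ^ k * m) (doublings k ds)
  doublings-isDivisorList k = record
    { unique = doublings-unique k
    ; ∈⇔∣    = mk⇔ (∈-doublings⇒∣ k) (∣⇒∈-doublings k)
    }

odd⇒nonZero : Odd m → NonZero m
odd⇒nonZero {zero}  odd = contradiction (2 ∣0) odd
odd⇒nonZero {suc m} odd = _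

-- σ(2ᵏm) = (2ᵏ⁺¹ − 1) σ(m), moved around to avoid truncated subtraction.
σ[2^k*m]+σ[m] : ∀ k → Odd m → σ (2 ^ k * m) + σ m ≡ 2 ^ suc k * σ m
σ[2^k*m]+σ[m] {m} k odd = begin
  σ (2 ^ k * m) + σ m                   ≡⟨ cong (_+ σ m) (σ≡sum (doublings-isDivisorList odd divisors-isDivisorList k)) ⟩
  sum (doublings k (divisors m)) + σ m  ≡⟨ sum-doublings k (divisors m) ⟩
  2 ^ suc k * σ m                       ∎
  where
  open ≡-Reasoning
  instance
    _ = odd⇒nonZero odd
    _ = m*n≢0 (2 ^ k) m {{m^n≢0 2 k}}

squareDivisors : ℕ → List ℕ
squareDivisors p = 1 ∷ p ∷ p * p ∷ []

module _ {p} (p-prime : Prime p) where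
  instance
    _ = prime⇒nonZero p-prime
    _ = prime⇒nonTrivial p-prime
    _ = m*n≢0 p p

  ∣p*p⇒∈squareDivisors : x ∣ p * p → x ∈ squareDivisors p
  ∣p*p⇒∈squareDivisors {x} x∣pp with p ∣? x
  ... | no p∤x with prime⇒irreducible p-prime (coprime-divisor (prime∤⇒coprime p-prime p∤x) x∣pp)
  ...   | inj₁ refl = here refl
  ...   | inj₂ refl = there (here refl)
  ∣p*p⇒∈squareDivisors x∣pp | yes (divides y refl)
    with prime⇒irreducible p-prime (*-cancelʳ-∣ {y} {p} p x∣pp)
  ... | inj₁ refl = there (here (+-identityʳ p))
  ... | inj₂ refl = there (there (here refl))

  ∈squareDivisors⇒∣p*p : x ∈ squareDivisors p → x ∣ p * p
  ∈squareDivisors⇒∣p*p (here refl)                = 1∣ _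
  ∈squareDivisors⇒∣p*p (there (here refl))         = m∣m*n p
  ∈squareDivisors⇒∣p*p (there (there (here refl))) = ∣-refl

  squareDivisors-unique : Unique (squareDivisors p)
  squareDivisors-unique =
    ((<⇒≢ 1<p) ∷ (<⇒≢ (<-trans 1<p p<p*p)) ∷ []) AllPairs.∷ ((<⇒≢ p<p*p ∷ []) AllPairs.∷ ([] AllPairs.∷ AllPairs.[]))
    where
    1<p : 1 < p
    1<p = nonTrivial⇒n>1 p
    p<p*p : p < p * p
    p<p*p = m<m*n p p 1<p

  squareDivisors-isDivisorList : IsDivisorList (p * p) (squareDivisors p)
  squareDivisors-isDivisorList = record
    { unique = squareDivisors-unique
    ; ∈⇔∣    = mk⇔ ∈squareDivisors⇒∣p*p ∣p*p⇒∈squareDivisors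
    }

  σ[p^2] : σ (p ^ 2) ≡ 1 + p + p ^ 2
  σ[p^2] rewrite p^2≡p*p p = trans (σ≡sum squareDivisors-isDivisorList) (sum≡ p)
    where
    sum≡ : ∀ p → 1 + (p + (p * p + 0)) ≡ 1 + p + p * p
    sum≡ = solve-∀

odd-p^2 : Odd p → Odd (p ^ 2)
odd-p^2 {p} odd-p = subst Odd (sym (p^2≡p*p p)) (odd*odd⇒odd odd-p odd-p)

odd-1+p+p^2 : ∀ p → Odd (1 + p + p ^ 2)
odd-1+p+p^2 p = even⇒odd-suc (even-n+n^2 p)

omittedDivisors-equation : ∀ {d₁ d₂} → Prime p → Odd p → OmittedDivisors (2 ^ k * p ^ 2) d₁ d₂ →
  d₁ + d₂ + 2 ^ suc k * p ^ 2 + (1 + p + p ^ 2) ≡ 2 ^ suc k * (1 + p + p ^ 2)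
omittedDivisors-equation {p} {k} {d₁} {d₂} p-prime odd-p (_ , _ , _ , _ , _ , σ≡) = begin
  d₁ + d₂ + 2 ^ suc k * P + C    ≡⟨ regroup d₁ d₂ (2 ^ k) P C ⟩
  2 * (2 ^ k * P) + d₁ + d₂ + C  ≡⟨ cong₂ _+_ σ≡ (σ[p^2] p-prime) ⟨
  σ (2 ^ k * P) + σ P            ≡⟨ σ[2^k*m]+σ[m] k (odd-p^2 odd-p) ⟩
  2 ^ suc k * σ P                ≡⟨ cong (2 ^ suc k *_) (σ[p^2] p-prime) ⟩
  2 ^ suc k * C                  ∎
  where
  open ≡-Reasoning
  P = p ^ 2
  C = 1 + p + P
  regroup : ∀ d₁ d₂ u P C → d₁ + d₂ + 2 * u * P + C ≡ 2 * (u * P) + d₁ + d₂ + C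
  regroup = solve-∀

balance⇒odd : ∀ {a t P c} → Even t → Odd c → a + t * P + c ≡ t * c → Odd a
balance⇒odd {a} {t} {P} {c} 2∣t odd-c eq 2∣a =
  odd-c (∣m+n∣m⇒∣n (subst (2 ∣_) (sym eq) (∣-trans 2∣t (m∣m*n c))) (∣m∣n⇒∣m+n 2∣a (∣-trans 2∣t (m∣m*n P))))

balance⇒ℤ-formula : ∀ {a t P p} → a + t * P + (1 + p + P) ≡ t * (1 + p + P) →
  + a ≡ - + P ℤ.+ (+ t ℤ.- + 1) ℤ.* + p ℤ.+ (+ t ℤ.- + 1)
balance⇒ℤ-formula {a} {t} {P} {p} eq = begin
  + a                                                  ≡⟨ cancel (+ a) (+ t) (+ P) (+ p) ⟩
  + a ℤ.+ + t ℤ.* + P ℤ.+ + c ℤ.- + t ℤ.* + P ℤ.- + c  ≡⟨ cong (λ z → z ℤ.- + t ℤ.* + P ℤ.- + c) lifted ⟩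
  + t ℤ.* + c ℤ.- + t ℤ.* + P ℤ.- + c                  ≡⟨ expand (+ t) (+ P) (+ p) ⟩
  - + P ℤ.+ (+ t ℤ.- + 1) ℤ.* + p ℤ.+ (+ t ℤ.- + 1)    ∎
  where
  open ≡-Reasoning
  c = 1 + p + P
  lifted : + a ℤ.+ + t ℤ.* + P ℤ.+ + c ≡ + t ℤ.* + c
  lifted = trans (cong (λ z → + a ℤ.+ z ℤ.+ + c) (sym (pos-* t P))) (trans (cong +_ eq) (pos-* t c))
  cancel : ∀ a t P p → a ≡ a ℤ.+ t ℤ.* P ℤ.+ (+ 1 ℤ.+ p ℤ.+ P) ℤ.- t ℤ.* P ℤ.- (+ 1 ℤ.+ p ℤ.+ P)
  cancel = ℤ-Solver.solve-∀
  expand : ∀ t P p → t ℤ.* (+ 1 ℤ.+ p ℤ.+ P) ℤ.- t ℤ.* P ℤ.- (+ 1 ℤ.+ p ℤ.+ P) ≡ - P ℤ.+ (t ℤ.- + 1) ℤ.* p ℤ.+ (t ℤ.- + 1)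
  expand = ℤ-Solver.solve-∀

lemma7 : (k p d₁ d₂ : ℕ) → Prime p → Odd p →
    OmittedDivisors (2 ^ k * p ^ 2) d₁ d₂ →
    (Data.Integer._+_ (+ d₁) (+ d₂) ≡ Data.Integer._+_ (Data.Integer._+_ (- (+ (p ^ 2))) (Data.Integer._*_ (Data.Integer._-_ (+ (2 ^ (k + 1))) (+ 1)) (+ p))) (Data.Integer._-_ (+ (2 ^ (k + 1))) (+ 1)))
    × ((Even d₁ × Odd d₂) ⊎ (Odd d₁ × Even d₂))
lemma7 k p d₁ d₂ p-prime odd-p omitted =
  balance⇒ℤ-formula {t = 2 ^ (k + 1)} {P = p ^ 2} {p = p} (subst (λ t → d₁ + d₂ + t * p ^ 2 + C ≡ t * C) (cong (2 ^_) (+-comm 1 k)) equation) ,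
  odd-sum⇒opposite-parity (balance⇒odd {P = p ^ 2} (m∣m*n (2 ^ k)) (odd-1+p+p^2 p) equation)
  where
  C = 1 + p + p ^ 2
  equation : d₁ + d₂ + 2 ^ suc k * p ^ 2 + C ≡ 2 ^ suc k * C
  equation = omittedDivisors-equation {k = k} p-prime odd-p omitted
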